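{- Let $n$ be even. Inserting the sequence $1, n, 2, n-1, \ldots, n/2, n/2+1$ into an initially empty binary search tree, applying \textsc{RebalanceZig} after each insertion, results for $0<p<1$ in a binary search tree having an external leaf with expected depth at least $\frac{p(1-p)}{2}n$. For $p=0$ and for $p=1$ the resulting tree is a single path.
   Context: Each new element is first placed as a new leaf $v$ at its standard unbalanced BST position, and then \textsc{RebalanceZig}$(v)$ is applied: while $v$ has a parent and an independent coin flip shows tail (tail has probability $p$, head probability $1-p$), set $v\gets$ parent of $v$; afterwards, if $v$ has a parent, rotate $v$ up (the standard single rotation at the parent of $v$ that moves $v$ one level up). External leaves are the empty (nil) child positions of the tree; the depth of a position is the number of edges from the root to it. Expectation is over the coin flips.
   Formalization: The tail probability p ranges only over rationals with $0<p<1$, so the expected depth is computed over ℚ. -}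

module Defs where

open import Data.Nat as ℕ using (ℕ; zero; suc; _<ᵇ_)
open import Data.Bool using (if_then_else_)
open import Data.List using (List; []; _∷_; map; concat; concatMap; upTo; foldr)
open import Data.Product using (_×_; _,_)
open import Data.Integer using (+_)
open import Data.Rational using (ℚ; _+_; _*_; _-_; 1ℚ; 0ℚ; _/_)

-- Binary search trees with natural-number keys (leaf = external leaf / nil).
data Tree : Set where
  leaf : Tree
  node : Tree → ℕ → Tree → Tree

-- Zipper frames: the focus is the left child (goL y r) or right child (goR l y)
-- of a parent with key y.
data Frame : Set where
  goL : ℕ → Tree → Frame
  goR : Tree → ℕ → Frame

-- Context: list of frames, innermost (parent of focus) first.
Ctx : Set
Ctx = List Frame

plugFrame : Tree → Frame → Tree
plugFrame t (goL y r) = node t y r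
plugFrame t (goR l y) = node l y t

plug : Tree → Ctx → Tree
plug t []       = t
plug t (f ∷ fs) = plug (plugFrame t f) fs

rotUp : Tree → Frame → Tree
rotUp (node a x b) (goL y r) = node a x (node b y r)
rotUp (node a x b) (goR l y) = node (node l y a) x b
rotUp leaf         f         = plugFrame leaf f

-- Finite distributions: lists of (probability weight, outcome).
Dist : Set
Dist = List (ℚ × Tree)

scale : ℚ → Dist → Dist
scale p = map (λ { (w , t) → (p * w , t) })

-- RebalanceZig from focus v with context ctx, tail probability p:
-- if v has no parent: stop (no rotation);
-- otherwise with prob 1-p (head) stop and rotate v up at its parent,
-- with prob p (tail) move v to its parent and continue.
rebalanceZig : ℚ → Tree → Ctx → Dist
rebalanceZig p v []       = (1ℚ , v) ∷ []
rebalanceZig p v (f ∷ fs) =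
  (1ℚ - p , plug (rotUp v f) fs) ∷ scale p (rebalanceZig p (plugFrame v f) fs)

insertZig : ℚ → ℕ → Tree → Ctx → Dist
insertZig p x leaf         ctx = rebalanceZig p (node leaf x leaf) ctx
insertZig p x (node l y r) ctx =
  if x <ᵇ y then insertZig p x l (goL y r ∷ ctx)
            else insertZig p x r (goR l y ∷ ctx)

stepDist : ℚ → ℕ → Dist → Dist
stepDist p x d = concatMap (λ { (w , t) → scale w (insertZig p x t []) }) d

runFrom : ℚ → List ℕ → Dist → Dist
runFrom p []       d = d
runFrom p (x ∷ xs) d = runFrom p xs (stepDist p x d)

run : ℚ → List ℕ → Dist
run p xs = runFrom p xs ((1ℚ , leaf) ∷ [])

-- The insertion sequence 1, n, 2, n-1, ..., m, m+1 for n = 2m.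
altSeq : ℕ → List ℕ
altSeq m = concat (map (λ j → j ∷ (suc (2 ℕ.* m) ℕ.∸ j) ∷ []) (map suc (upTo m)))

-- Depth of the external leaf (nil position) in gap i, i.e. the position
-- between keys i and i+1 (where a search for i + 1/2 ends).
extDepth : ℕ → Tree → ℕ
extDepth i leaf         = 0
extDepth i (node l y r) = suc (if i <ᵇ y then extDepth i l else extDepth i r)

expect : Dist → (Tree → ℚ) → ℚ
expect d g = foldr (λ { (w , t) acc → w * g t + acc }) 0ℚ d

ℕtoℚ : ℕ → ℚ
ℕtoℚ n = + n / 1

data IsPath : Tree → Set where
  path-leaf  : IsPath leaf
  path-none  : ∀ x → IsPath (node leaf x leaf)
  path-left  : ∀ l x → IsPath l → IsPath (node l x leaf)
  path-right : ∀ x r → IsPath r → IsPath (node leaf x r)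

module Submission where

-- Every key of the sequence is inserted next to the middle gap (between m and m + 1): the new node x
-- takes the place of the external leaf of that gap, which becomes a child of x on some side c.
-- RebalanceZig rotates at most one node, which lifts the gap by at most one level, and not at all
-- when the gap and the parent of the rotated node lie on opposite sides of it. The previous key was
-- inserted on the other side of the gap, so x or its parent is a child on the side opposite to c;
-- it is the one rotated with probability 1 - p, resp. p(1 - p). Hence every insertion increases the
-- expected depth of the gap by at least p(1 - p), and the 2m insertions by 2m p(1 - p). For p = 1
-- no rotation happens and for p = 0 exactly one, and the trees of positive weight stay paths.

open import Defs
open import Data.Nat using (ℕ; zero; suc; _<ᵇ_; z≤n; s≤s; z<s)
import Data.Nat as ℕ
import Data.Nat.Properties as ℕ
open import Data.Nat.Tactic.RingSolver using (solve-∀)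
open import Data.Nat.Coprimality using (1-coprimeTo) renaming (sym to coprime-sym)
import Data.Integer as ℤ
import Data.Integer.Properties as ℤ
open import Data.Rational using (ℚ; _≤_; _<_; _+_; _*_; _-_; -_; 0ℚ; 1ℚ; ½; nonNegative)
open import Data.Rational.Properties
  using ( ≤-refl; ≤-trans; ≤-reflexive; <⇒≤; positive⁻¹; +-mono-≤; +-monoʳ-≤; +-monoˡ-≤
        ; *-monoˡ-≤-nonNeg; *-zeroʳ; *-zeroˡ; *-identityʳ; *-identityˡ; +-identityʳ; +-identityˡ
        ; +-assoc; +-inverseʳ; normalize-coprime; /-cong; module ≤-Reasoning)
open import Data.Rational.Solver using (module +-*-Solver)
open import Data.Bool using (Bool; true; false; not; if_then_else_)
open import Data.Product using (Σ; _×_; _,_; proj₁; proj₂)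
open import Data.Sum using (_⊎_; inj₁; inj₂)
open import Data.Empty using (⊥-elim)
open import Data.List using (List; []; _∷_; _++_; map; length; concat; applyUpTo)
open import Data.List.Properties using (map-++)
open import Data.List.Relation.Unary.All as All using (All; []; _∷_)
open import Data.List.Relation.Unary.All.Properties using (++⁺; map⁺)
open import Data.List.Membership.Propositional using (_∈_)
open import Function using (id; _∘_)
open import Relation.Binary.PropositionalEquality
  using (_≡_; _≢_; refl; sym; trans; cong; cong₂; subst; module ≡-Reasoning)

open +-*-Solver using (solve; _:+_; _:*_; _:-_; _:=_; con)

ℕtoℚ-suc : ∀ n → ℕtoℚ (suc n) ≡ ℕtoℚ n + 1ℚ
ℕtoℚ-suc n rewrite normalize-coprime (coprime-sym (1-coprimeTo n)) =
  /-cong {p₁ = ℤ.+ suc n} (sym numerator) refl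
  where
  numerator : ℤ.+ n ℤ.* ℤ.+ 1 ℤ.+ ℤ.+ 1 ℤ.* ℤ.+ 1 ≡ ℤ.+ suc n
  numerator = trans (cong (ℤ._+ ℤ.+ 1) (ℤ.*-identityʳ (ℤ.+ n))) (cong ℤ.+_ (ℕ.+-comm n 1))

0≤1 : 0ℚ ≤ 1ℚ
0≤1 = <⇒≤ (positive⁻¹ 1ℚ)

p≤p+q : ∀ {p q} → 0ℚ ≤ q → p ≤ p + q
p≤p+q {p} 0≤q = ≤-trans (≤-reflexive (sym (+-identityʳ p))) (+-monoʳ-≤ p 0≤q)

0≤1-p : ∀ {p} → p ≤ 1ℚ → 0ℚ ≤ 1ℚ - p
0≤1-p {p} p≤1 = ≤-trans (≤-reflexive (sym (+-inverseʳ p))) (+-monoˡ-≤ (- p) p≤1)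

*-monoˡ-≤-0≤ : ∀ {r p q} → 0ℚ ≤ r → p ≤ q → r * p ≤ r * q
*-monoˡ-≤-0≤ {r} 0≤r = *-monoˡ-≤-nonNeg r {{nonNegative 0≤r}}

0≤* : ∀ {p q} → 0ℚ ≤ p → 0ℚ ≤ q → 0ℚ ≤ p * q
0≤* {p} 0≤p 0≤q = ≤-trans (≤-reflexive (sym (*-zeroʳ p))) (*-monoˡ-≤-0≤ 0≤p 0≤q)

ℕtoℚ-nonNeg : ∀ n → 0ℚ ≤ ℕtoℚ n
ℕtoℚ-nonNeg zero    = ≤-refl
ℕtoℚ-nonNeg (suc n) = subst (0ℚ ≤_) (sym (ℕtoℚ-suc n)) (+-mono-≤ (ℕtoℚ-nonNeg n) 0≤1)

ℕtoℚ-+ : ∀ m n → ℕtoℚ (m ℕ.+ n) ≡ ℕtoℚ m + ℕtoℚ n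
ℕtoℚ-+ zero    n = sym (+-identityˡ (ℕtoℚ n))
ℕtoℚ-+ (suc m) n = begin
  ℕtoℚ (suc (m ℕ.+ n))
    ≡⟨ ℕtoℚ-suc (m ℕ.+ n) ⟩
  ℕtoℚ (m ℕ.+ n) + 1ℚ
    ≡⟨ cong (_+ 1ℚ) (ℕtoℚ-+ m n) ⟩
  ℕtoℚ m + ℕtoℚ n + 1ℚ
    ≡⟨ solve 2 (λ a b → a :+ b :+ con 1ℚ := a :+ con 1ℚ :+ b) refl (ℕtoℚ m) (ℕtoℚ n) ⟩
  ℕtoℚ m + 1ℚ + ℕtoℚ n
    ≡⟨ cong (_+ ℕtoℚ n) (ℕtoℚ-suc m) ⟨
  ℕtoℚ (suc m) + ℕtoℚ n
    ∎
  where open ≡-Reasoning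

ℕtoℚ-mono-≤ : ∀ {m n} → m ℕ.≤ n → ℕtoℚ m ≤ ℕtoℚ n
ℕtoℚ-mono-≤ {m} m≤n with ℕ.m≤n⇒∃[o]m+o≡n m≤n
... | o , refl = ≤-trans (p≤p+q (ℕtoℚ-nonNeg o)) (≤-reflexive (sym (ℕtoℚ-+ m o)))

weight : Dist → ℚ
weight d = expect d (λ _ → 1ℚ)

depthℚ : ℕ → Tree → ℚ
depthℚ h t = ℕtoℚ (extDepth h t)

ZeroOr : (Tree → Set) → ℚ × Tree → Set
ZeroOr Q e = proj₁ e ≡ 0ℚ ⊎ Q (proj₂ e)

ZeroOr-map : ∀ (Q Q′ : Tree → Set) → (∀ {t} → Q t → Q′ t) → ∀ {e} → ZeroOr Q e → ZeroOr Q′ e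
ZeroOr-map Q Q′ f (inj₁ w≡0) = inj₁ w≡0
ZeroOr-map Q Q′ f (inj₂ q)   = inj₂ (f q)

expect-++ : ∀ d d′ g → expect (d ++ d′) g ≡ expect d g + expect d′ g
expect-++ []            d′ g = sym (+-identityˡ _)
expect-++ ((w , t) ∷ d) d′ g =
  trans (cong (w * g t +_) (expect-++ d d′ g)) (sym (+-assoc (w * g t) _ _))

expect-scale : ∀ a d g → expect (scale a d) g ≡ a * expect d g
expect-scale a []            g = sym (*-zeroʳ a)
expect-scale a ((w , t) ∷ d) g =
  trans (cong ((a * w) * g t +_) (expect-scale a d g))
        (solve 4 (λ a w x e → a :* w :* x :+ a :* e := a :* (w :* x :+ e)) refl a w (g t) (expect d g))

expect-≥ : ∀ {L g} d → All (λ e → 0ℚ ≤ proj₁ e × L ≤ g (proj₂ e)) d → L * weight d ≤ expect d g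
expect-≥ {L} []                 []                  = ≤-reflexive (*-zeroʳ L)
expect-≥ {L} {g} ((w , t) ∷ d) ((0≤w , L≤g) ∷ rest) = begin
  L * (w * 1ℚ + weight d)
    ≡⟨ solve 3 (λ L w W → L :* (w :* con 1ℚ :+ W) := w :* L :+ L :* W) refl L w (weight d) ⟩
  w * L + L * weight d
    ≤⟨ +-mono-≤ (*-monoˡ-≤-0≤ 0≤w L≤g) (expect-≥ d rest) ⟩
  w * g t + expect d g
    ∎
  where open ≤-Reasoning

module _ {p : ℚ} {x : ℕ} where

  expect-stepDist-∷ : ∀ w t d g → expect (stepDist p x ((w , t) ∷ d)) g
                                ≡ w * expect (insertZig p x t []) g + expect (stepDist p x d) g
  expect-stepDist-∷ w t d g = trans (expect-++ (scale w (insertZig p x t [])) (stepDist p x d) g)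
    (cong (_+ expect (stepDist p x d) g) (expect-scale w (insertZig p x t []) g))

  stepDist-All : ∀ {P Q : ℚ × Tree → Set} d →
    (∀ {w t} → P (w , t) → All (λ e → Q (w * proj₁ e , proj₂ e)) (insertZig p x t [])) →
    All P d → All Q (stepDist p x d)
  stepDist-All []            ins []        = []
  stepDist-All ((w , t) ∷ d) ins (pw ∷ pd) = ++⁺ (map⁺ (ins pw)) (stepDist-All d ins pd)

  stepDist-weight : ∀ d → All (λ e → weight (insertZig p x (proj₂ e) []) ≡ 1ℚ) d →
    weight (stepDist p x d) ≡ weight d
  stepDist-weight []            []           = refl
  stepDist-weight ((w , t) ∷ d) (one ∷ ones) = trans (expect-stepDist-∷ w t d _)
    (cong₂ (λ a b → w * a + b) one (stepDist-weight d ones))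

  stepDist-expect-≥ : ∀ {q g g′} d →
    All (λ e → 0ℚ ≤ proj₁ e × g (proj₂ e) + q ≤ expect (insertZig p x (proj₂ e) []) g′) d →
    expect d g + q * weight d ≤ expect (stepDist p x d) g′
  stepDist-expect-≥ {q} [] [] = ≤-reflexive (solve 1 (λ q → con 0ℚ :+ q :* con 0ℚ := con 0ℚ) refl q)
  stepDist-expect-≥ {q} {g} {g′} ((w , t) ∷ d) ((0≤w , gain) ∷ gains) = begin
    w * g t + expect d g + q * (w * 1ℚ + weight d)
      ≡⟨ solve 5 (λ w a E q W → w :* a :+ E :+ q :* (w :* con 1ℚ :+ W) := w :* (a :+ q) :+ (E :+ q :* W))
                 refl w (g t) (expect d g) q (weight d) ⟩
    w * (g t + q) + (expect d g + q * weight d)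
      ≤⟨ +-mono-≤ (*-monoˡ-≤-0≤ 0≤w gain) (stepDist-expect-≥ d gains) ⟩
    w * expect (insertZig p x t []) g′ + expect (stepDist p x d) g′
      ≡⟨ expect-stepDist-∷ w t d g′ ⟨
    expect (stepDist p x ((w , t) ∷ d)) g′
      ∎
    where open ≤-Reasoning

  stepDist-zeroOr : ∀ {Q Q′} d → (∀ {t} → Q t → All (ZeroOr Q′) (insertZig p x t [])) →
    All (ZeroOr Q) d → All (ZeroOr Q′) (stepDist p x d)
  stepDist-zeroOr {Q} {Q′} d ins = stepDist-All d outcomes
    where
    outcomes : ∀ {w t} → ZeroOr Q (w , t) →
      All (λ e → ZeroOr Q′ (w * proj₁ e , proj₂ e)) (insertZig p x t [])
    outcomes     (inj₁ refl) = All.universal (λ e → inj₁ (*-zeroˡ (proj₁ e))) _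
    outcomes {w} (inj₂ q)    = All.map scaled (ins q)
      where
      scaled : ∀ {e} → ZeroOr Q′ e → ZeroOr Q′ (w * proj₁ e , proj₂ e)
      scaled (inj₁ w′≡0) = inj₁ (trans (cong (w *_) w′≡0) (*-zeroʳ w))
      scaled (inj₂ q′)   = inj₂ q′

zeroOr-IsPath : ∀ {Q : Tree → Set} {d} → (∀ {t} → Q t → IsPath t) → All (ZeroOr Q) d →
  (w : ℚ) (t : Tree) → (w , t) ∈ d → w ≢ 0ℚ → IsPath t
zeroOr-IsPath isPath all w t w,t∈d w≢0 with All.lookup all w,t∈d
... | inj₁ w≡0 = ⊥-elim (w≢0 w≡0)
... | inj₂ q   = isPath q

key : Frame → ℕ
key (goL y _) = y
key (goR _ y) = y

isLeft : Frame → Bool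
isLeft (goL _ _) = true
isLeft (goR _ _) = false

OnPath : ℕ → Frame → Set
OnPath h f = (h <ᵇ key f) ≡ isLeft f

searchPath : ℕ → Tree → Ctx → Ctx
searchPath h leaf         acc = acc
searchPath h (node l y r) acc =
  if h <ᵇ y then searchPath h l (goL y r ∷ acc) else searchPath h r (goR l y ∷ acc)

sides : Ctx → List Bool
sides = map isLeft

searchPath-++ : ∀ h t acc acc′ → searchPath h t (acc ++ acc′) ≡ searchPath h t acc ++ acc′
searchPath-++ h leaf         acc acc′ = refl
searchPath-++ h (node l y r) acc acc′ with h <ᵇ y
... | true  = searchPath-++ h l (goL y r ∷ acc) acc′
... | false = searchPath-++ h r (goR l y ∷ acc) acc′

sides-searchPath : ∀ h t acc → sides (searchPath h t acc) ≡ sides (searchPath h t []) ++ sides acc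
sides-searchPath h t acc =
  trans (cong sides (searchPath-++ h t [] acc)) (map-++ isLeft (searchPath h t []) acc)

plug-searchPath : ∀ h t acc → plug leaf (searchPath h t acc) ≡ plug t acc
plug-searchPath h leaf         acc = refl
plug-searchPath h (node l y r) acc with h <ᵇ y
... | true  = plug-searchPath h l (goL y r ∷ acc)
... | false = plug-searchPath h r (goR l y ∷ acc)

searchPath-onPath : ∀ h t {acc} → All (OnPath h) acc → All (OnPath h) (searchPath h t acc)
searchPath-onPath h leaf         ons = ons
searchPath-onPath h (node l y r) ons with h <ᵇ y in eq
... | true  = searchPath-onPath h l (eq ∷ ons)
... | false = searchPath-onPath h r (eq ∷ ons)

searchPath-plugFrame : ∀ {h} t f acc → OnPath h f →
  searchPath h (plugFrame t f) acc ≡ searchPath h t (f ∷ acc)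
searchPath-plugFrame t (goL y r) acc on rewrite on = refl
searchPath-plugFrame t (goR l y) acc on rewrite on = refl

searchPath-plug : ∀ {h} t ctx acc → All (OnPath h) ctx →
  searchPath h (plug t ctx) acc ≡ searchPath h t (ctx ++ acc)
searchPath-plug t []       acc []         = refl
searchPath-plug t (f ∷ fs) acc (on ∷ ons) =
  trans (searchPath-plug (plugFrame t f) fs acc ons) (searchPath-plugFrame t f _ on)

extDepth-plugFrame : ∀ {h} t f → OnPath h f → extDepth h (plugFrame t f) ≡ suc (extDepth h t)
extDepth-plugFrame t (goL y r) on rewrite on = refl
extDepth-plugFrame t (goR l y) on rewrite on = refl

extDepth-plug : ∀ {h} t ctx → All (OnPath h) ctx → extDepth h (plug t ctx) ≡ extDepth h t ℕ.+ length ctx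
extDepth-plug t []       []         = sym (ℕ.+-identityʳ _)
extDepth-plug t (f ∷ fs) (on ∷ ons) =
  trans (extDepth-plug (plugFrame t f) fs ons)
        (trans (cong (ℕ._+ length fs) (extDepth-plugFrame t f on)) (sym (ℕ.+-suc _ (length fs))))

extDepth≡length-searchPath : ∀ h t → extDepth h t ≡ length (searchPath h t [])
extDepth≡length-searchPath h t =
  trans (cong (extDepth h) (sym (plug-searchPath h t [])))
        (extDepth-plug leaf (searchPath h t []) (searchPath-onPath h t []))

data AllKeys (P : ℕ → Set) : Tree → Set where
  leaf : AllKeys P leaf
  node : ∀ {l y r} → AllKeys P l → P y → AllKeys P r → AllKeys P (node l y r)

AllKeysFrame : (ℕ → Set) → Frame → Set
AllKeysFrame P (goL y r) = P y × AllKeys P r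
AllKeysFrame P (goR l y) = AllKeys P l × P y

AllKeys-map : ∀ {P Q : ℕ → Set} → (∀ {y} → P y → Q y) → ∀ {t} → AllKeys P t → AllKeys Q t
AllKeys-map f leaf         = leaf
AllKeys-map f (node l y r) = node (AllKeys-map f l) (f y) (AllKeys-map f r)

AllKeys-universal : ∀ {P : ℕ → Set} → (∀ y → P y) → ∀ t → AllKeys P t
AllKeys-universal u leaf         = leaf
AllKeys-universal u (node l y r) = node (AllKeys-universal u l) (u y) (AllKeys-universal u r)

AllKeys-plugFrame : ∀ {P t} f → AllKeys P t → AllKeysFrame P f → AllKeys P (plugFrame t f)
AllKeys-plugFrame (goL y r) kt (ky , kr) = node kt ky kr
AllKeys-plugFrame (goR l y) kt (kl , ky) = node kl ky kt

AllKeys-plug : ∀ {P t} ctx → AllKeys P t → All (AllKeysFrame P) ctx → AllKeys P (plug t ctx)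
AllKeys-plug []       kt []         = kt
AllKeys-plug (f ∷ fs) kt (kf ∷ kfs) = AllKeys-plug fs (AllKeys-plugFrame f kt kf) kfs

AllKeys-searchPath : ∀ {P} h t {acc} → AllKeys P t → All (AllKeysFrame P) acc →
  All (AllKeysFrame P) (searchPath h t acc)
AllKeys-searchPath h leaf         _               kacc = kacc
AllKeys-searchPath h (node l y r) (node kl ky kr) kacc with h <ᵇ y
... | true  = AllKeys-searchPath h l kl ((ky , kr) ∷ kacc)
... | false = AllKeys-searchPath h r kr ((kl , ky) ∷ kacc)

AllKeys-rotUp : ∀ {P} v f → AllKeys P v → AllKeysFrame P f → AllKeys P (rotUp v f)
AllKeys-rotUp (node a x b) (goL y r) (node ka kx kb) (ky , kr) = node ka kx (node kb ky kr)
AllKeys-rotUp (node a x b) (goR l y) (node ka kx kb) (kl , ky) = node (node kl ky ka) kx kb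
AllKeys-rotUp leaf         f         _               kf        = AllKeys-plugFrame f leaf kf

insertZig-searchPath : ∀ p x t ctx →
  insertZig p x t ctx ≡ rebalanceZig p (node leaf x leaf) (searchPath x t ctx)
insertZig-searchPath p x leaf         ctx = refl
insertZig-searchPath p x (node l y r) ctx with x <ᵇ y
... | true  = insertZig-searchPath p x l (goL y r ∷ ctx)
... | false = insertZig-searchPath p x r (goR l y ∷ ctx)

rebalanceZig-keys : ∀ {P} p v ctx → AllKeys P v → All (AllKeysFrame P) ctx →
  All (λ e → AllKeys P (proj₂ e)) (rebalanceZig p v ctx)
rebalanceZig-keys p v []       kv []         = kv ∷ []
rebalanceZig-keys p v (f ∷ fs) kv (kf ∷ kfs) =
  AllKeys-plug fs (AllKeys-rotUp v f kv kf) kfs ∷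
  map⁺ (rebalanceZig-keys p (plugFrame v f) fs (AllKeys-plugFrame f kv kf) kfs)

insertZig-keys : ∀ {P} p x t → AllKeys P t → P x → All (λ e → AllKeys P (proj₂ e)) (insertZig p x t [])
insertZig-keys p x t kt kx rewrite insertZig-searchPath p x t [] =
  rebalanceZig-keys p _ _ (node leaf kx leaf) (AllKeys-searchPath x t kt [])

SameSide : ℕ → ℕ → ℕ → Set
SameSide a b y = (a <ᵇ y) ≡ (b <ᵇ y)

searchPath-sameSide : ∀ {a b} t acc → AllKeys (SameSide a b) t → searchPath a t acc ≡ searchPath b t acc
searchPath-sameSide         leaf         acc _               = refl
searchPath-sameSide {a} {b} (node l y r) acc (node kl ky kr) rewrite ky with b <ᵇ y
... | true  = searchPath-sameSide l _ kl
... | false = searchPath-sameSide r _ kr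

extDepth-sameSide : ∀ {a b} t → AllKeys (SameSide a b) t → extDepth a t ≡ extDepth b t
extDepth-sameSide         leaf         _               = refl
extDepth-sameSide {a} {b} (node l y r) (node kl ky kr) rewrite ky with b <ᵇ y
... | true  = cong suc (extDepth-sameSide l kl)
... | false = cong suc (extDepth-sameSide r kr)

<⇒<ᵇ≡true : ∀ {m n} → m ℕ.< n → (m <ᵇ n) ≡ true
<⇒<ᵇ≡true {zero}  {suc n} _         = refl
<⇒<ᵇ≡true {suc m} {suc n} (s≤s m<n) = <⇒<ᵇ≡true m<n

≥⇒<ᵇ≡false : ∀ {m n} → n ℕ.≤ m → (m <ᵇ n) ≡ false
≥⇒<ᵇ≡false {m}     {zero}  _         = refl
≥⇒<ᵇ≡false {suc m} {suc n} (s≤s n≤m) = ≥⇒<ᵇ≡false n≤m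

Outside : ℕ → ℕ → ℕ → Set
Outside lo hi y = y ℕ.≤ lo ⊎ hi ℕ.≤ y

sameSide-outside : ∀ {lo hi a b y} → lo ℕ.≤ a → a ℕ.< hi → lo ℕ.≤ b → b ℕ.< hi →
  Outside lo hi y → SameSide a b y
sameSide-outside lo≤a _ lo≤b _ (inj₁ y≤lo) =
  trans (≥⇒<ᵇ≡false (ℕ.≤-trans y≤lo lo≤a)) (sym (≥⇒<ᵇ≡false (ℕ.≤-trans y≤lo lo≤b)))
sameSide-outside _ a<hi _ b<hi (inj₂ hi≤y) =
  trans (<⇒<ᵇ≡true (ℕ.<-≤-trans a<hi hi≤y)) (sym (<⇒<ᵇ≡true (ℕ.<-≤-trans b<hi hi≤y)))

Outside-mono : ∀ {lo lo′ hi hi′ y} → lo ℕ.≤ lo′ → hi′ ℕ.≤ hi → Outside lo hi y → Outside lo′ hi′ y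
Outside-mono lo≤lo′ _      (inj₁ y≤lo) = inj₁ (ℕ.≤-trans y≤lo lo≤lo′)
Outside-mono _      hi′≤hi (inj₂ hi≤y) = inj₂ (ℕ.≤-trans hi′≤hi hi≤y)

-- Rotations and the depth of a gap

extDepth-singleton : ∀ h x → extDepth h (node leaf x leaf) ≡ 1
extDepth-singleton h x with h <ᵇ x
... | true  = refl
... | false = refl

extDepth-plug-singleton : ∀ {h} x ctx → All (OnPath h) ctx →
  extDepth h (plug (node leaf x leaf) ctx) ≡ suc (length ctx)
extDepth-plug-singleton {h} x ctx ons =
  trans (extDepth-plug _ ctx ons) (cong (ℕ._+ length ctx) (extDepth-singleton h x))

extDepth-rotUp-≥ : ∀ {h} v f → OnPath h f → extDepth h v ℕ.≤ extDepth h (rotUp v f)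
extDepth-rotUp-≥     leaf         f         _  = z≤n
extDepth-rotUp-≥ {h} (node a x b) (goL y r) on rewrite on with h <ᵇ x
... | true  = ℕ.≤-refl
... | false = ℕ.n≤1+n _
extDepth-rotUp-≥ {h} (node a x b) (goR l y) on rewrite on with h <ᵇ x
... | true  = ℕ.n≤1+n _
... | false = ℕ.≤-refl

-- When the gap and the parent lie on opposite sides of the rotated node, the gap keeps its depth.
extDepth-rotUp-away : ∀ {h} a x b f → OnPath h f → isLeft f ≡ not (h <ᵇ x) →
  extDepth h (rotUp (node a x b) f) ≡ suc (extDepth h (node a x b))
extDepth-rotUp-away {h} a x b (goL y r) on away rewrite on with h <ᵇ x | away
... | false | _  = refl
... | true  | ()
extDepth-rotUp-away {h} a x b (goR l y) on away rewrite on with h <ᵇ x | away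
... | true  | _  = refl
... | false | ()

extDepth-rotUp-plugFrame-away : ∀ {h} v f f′ → OnPath h f → OnPath h f′ → isLeft f′ ≡ not (isLeft f) →
  extDepth h (rotUp (plugFrame v f) f′) ≡ suc (extDepth h (plugFrame v f))
extDepth-rotUp-plugFrame-away v (goL y r) f′ on on′ away =
  extDepth-rotUp-away v y r f′ on′ (trans away (cong not (sym on)))
extDepth-rotUp-plugFrame-away v (goR l y) f′ on on′ away =
  extDepth-rotUp-away l y v f′ on′ (trans away (cong not (sym on)))

extDepth-plug-rotUp : ∀ {h} v f fs → All (OnPath h) (f ∷ fs) →
  extDepth h (plug v (f ∷ fs)) ℕ.≤ suc (extDepth h (plug (rotUp v f) fs))
extDepth-plug-rotUp {h} v f fs (on ∷ ons) = begin
  extDepth h (plug (plugFrame v f) fs)        ≡⟨ extDepth-plug (plugFrame v f) fs ons ⟩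
  extDepth h (plugFrame v f) ℕ.+ length fs    ≡⟨ cong (ℕ._+ length fs) (extDepth-plugFrame v f on) ⟩
  suc (extDepth h v ℕ.+ length fs)            ≤⟨ s≤s (ℕ.+-monoˡ-≤ (length fs) (extDepth-rotUp-≥ v f on)) ⟩
  suc (extDepth h (rotUp v f) ℕ.+ length fs)  ≡⟨ cong suc (extDepth-plug (rotUp v f) fs ons) ⟨
  suc (extDepth h (plug (rotUp v f) fs))      ∎
  where open ℕ.≤-Reasoning

expect-rebalanceZig-∷ : ∀ p v f fs g → expect (rebalanceZig p v (f ∷ fs)) g
  ≡ (1ℚ - p) * g (plug (rotUp v f) fs) + p * expect (rebalanceZig p (plugFrame v f) fs) g
expect-rebalanceZig-∷ p v f fs g =
  cong ((1ℚ - p) * g (plug (rotUp v f) fs) +_) (expect-scale p (rebalanceZig p (plugFrame v f) fs) g)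

rebalanceZig-weight : ∀ p v ctx → weight (rebalanceZig p v ctx) ≡ 1ℚ
rebalanceZig-weight p v []       = refl
rebalanceZig-weight p v (f ∷ fs) = begin
  weight (rebalanceZig p v (f ∷ fs))
    ≡⟨ expect-rebalanceZig-∷ p v f fs _ ⟩
  (1ℚ - p) * 1ℚ + p * weight (rebalanceZig p (plugFrame v f) fs)
    ≡⟨ cong (λ w → (1ℚ - p) * 1ℚ + p * w) (rebalanceZig-weight p _ fs) ⟩
  (1ℚ - p) * 1ℚ + p * 1ℚ
    ≡⟨ solve 1 (λ p → (con 1ℚ :- p) :* con 1ℚ :+ p :* con 1ℚ := con 1ℚ) refl p ⟩
  1ℚ
    ∎
  where open ≡-Reasoning

rebalanceZig-nonNeg : ∀ {p} → 0ℚ ≤ p → p ≤ 1ℚ → ∀ v ctx →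
  All (λ e → 0ℚ ≤ proj₁ e) (rebalanceZig p v ctx)
rebalanceZig-nonNeg 0≤p p≤1 v []       = 0≤1 ∷ []
rebalanceZig-nonNeg 0≤p p≤1 v (f ∷ fs) =
  0≤1-p p≤1 ∷ map⁺ (All.map (0≤* 0≤p) (rebalanceZig-nonNeg 0≤p p≤1 (plugFrame v f) fs))

rebalanceZig-extDepth : ∀ {h} p v ctx → All (OnPath h) ctx →
  All (λ e → extDepth h (plug v ctx) ℕ.≤ suc (extDepth h (proj₂ e))) (rebalanceZig p v ctx)
rebalanceZig-extDepth p v []       []             = ℕ.n≤1+n _ ∷ []
rebalanceZig-extDepth p v (f ∷ fs) ons@(_ ∷ ons′) =
  extDepth-plug-rotUp v f fs ons ∷ map⁺ (rebalanceZig-extDepth p (plugFrame v f) fs ons′)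

rebalanceZig-expect-≥ : ∀ {h p n} → 0ℚ ≤ p → p ≤ 1ℚ → ∀ v ctx → All (OnPath h) ctx →
  suc n ℕ.≤ extDepth h (plug v ctx) → ℕtoℚ n ≤ expect (rebalanceZig p v ctx) (depthℚ h)
rebalanceZig-expect-≥ {h} {p} {n} 0≤p p≤1 v ctx ons n<depth = begin
  ℕtoℚ n                                    ≡⟨ *-identityʳ (ℕtoℚ n) ⟨
  ℕtoℚ n * 1ℚ                               ≡⟨ cong (ℕtoℚ n *_) (rebalanceZig-weight p v ctx) ⟨
  ℕtoℚ n * weight (rebalanceZig p v ctx)    ≤⟨ expect-≥ _ (All.zipWith bound (nonNeg , lifted)) ⟩
  expect (rebalanceZig p v ctx) (depthℚ h)  ∎
  where
  open ≤-Reasoning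
  nonNeg = rebalanceZig-nonNeg 0≤p p≤1 v ctx
  lifted = rebalanceZig-extDepth p v ctx ons
  bound : ∀ {e} → 0ℚ ≤ proj₁ e × extDepth h (plug v ctx) ℕ.≤ suc (extDepth h (proj₂ e)) →
          0ℚ ≤ proj₁ e × ℕtoℚ n ≤ depthℚ h (proj₂ e)
  bound (0≤w , le) = 0≤w , ℕtoℚ-mono-≤ (ℕ.≤-pred (ℕ.≤-trans n<depth le))

data StartsWith (c : Bool) : List Bool → Set where
  here : ∀ {b bs} → b ≡ c → StartsWith c (b ∷ bs)

data InFirstTwo (c : Bool) : List Bool → Set where
  first  : ∀ {b bs} → b ≡ c → InFirstTwo c (b ∷ bs)
  second : ∀ {b b′ bs} → b′ ≡ c → InFirstTwo c (b ∷ b′ ∷ bs)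

-- The condition on the gap's search path before a key on side c of the gap is inserted.
ReadyFor : Bool → List Bool → Set
ReadyFor c bs = bs ≡ [] ⊎ InFirstTwo (not c) bs

StartsWith-++ : ∀ {c bs} bs′ → StartsWith c bs → StartsWith c (bs ++ bs′)
StartsWith-++ bs′ (here e) = here e

InFirstTwo-++ : ∀ {c bs} bs′ → InFirstTwo c bs → InFirstTwo c (bs ++ bs′)
InFirstTwo-++ bs′ (first e)  = first e
InFirstTwo-++ bs′ (second e) = second e

StartsWith⇒InFirstTwo : ∀ {c bs} → StartsWith c bs → InFirstTwo c bs
StartsWith⇒InFirstTwo (here e) = first e

StartsWith-∷ʳ : ∀ {c} bs b b′ → StartsWith c (bs ++ b ∷ []) → InFirstTwo c (bs ++ b′ ∷ b ∷ [])
StartsWith-∷ʳ []       b b′ (here e) = second e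
StartsWith-∷ʳ (_ ∷ bs) b b′ (here e) = first e

startsWith-singleton : ∀ {h x c} → (h <ᵇ x) ≡ c → StartsWith c (sides (searchPath h (node leaf x leaf) []))
startsWith-singleton {h} {x} hx with h <ᵇ x
... | true  = here hx
... | false = here hx

-- A rotation pushes the lowest frame of the gap at most one position up its search path.
rotUp-inFirstTwo : ∀ {h c} w f → OnPath h f → StartsWith c (sides (searchPath h w [])) →
  InFirstTwo c (sides (searchPath h (rotUp w f) []))
rotUp-inFirstTwo {h} (node a x b) (goL y r) on s with h <ᵇ x
... | true  rewrite sides-searchPath h a (goL x (node b y r) ∷ [])
                  | sides-searchPath h a (goL x b ∷ []) =
  StartsWith⇒InFirstTwo s
... | false rewrite on
                  | sides-searchPath h b (goL y r ∷ goR a x ∷ [])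
                  | sides-searchPath h b (goR a x ∷ []) =
  StartsWith-∷ʳ (sides (searchPath h b [])) false true s
rotUp-inFirstTwo {h} (node a x b) (goR l y) on s with h <ᵇ x
... | true  rewrite on
                  | sides-searchPath h a (goR l y ∷ goL x b ∷ [])
                  | sides-searchPath h a (goL x b ∷ []) =
  StartsWith-∷ʳ (sides (searchPath h a [])) true false s
... | false rewrite sides-searchPath h b (goR (node l y a) x ∷ [])
                  | sides-searchPath h b (goR a x ∷ []) =
  StartsWith⇒InFirstTwo s

rebalanceZig-inFirstTwo : ∀ {h c} p w ctx → All (OnPath h) ctx → StartsWith c (sides (searchPath h w [])) →
  All (λ e → InFirstTwo c (sides (searchPath h (proj₂ e) []))) (rebalanceZig p w ctx)
rebalanceZig-inFirstTwo p w [] [] s = StartsWith⇒InFirstTwo s ∷ []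
rebalanceZig-inFirstTwo {h} {c} p w (f ∷ fs) (on ∷ ons) s =
  rotated ∷ map⁺ (rebalanceZig-inFirstTwo p (plugFrame w f) fs ons climbed)
  where
  rotated : InFirstTwo c (sides (searchPath h (plug (rotUp w f) fs) []))
  rotated rewrite searchPath-plug (rotUp w f) fs [] ons | sides-searchPath h (rotUp w f) (fs ++ []) =
    InFirstTwo-++ _ (rotUp-inFirstTwo w f on s)
  climbed : StartsWith c (sides (searchPath h (plugFrame w f) []))
  climbed rewrite searchPath-plugFrame w f [] on | sides-searchPath h w (f ∷ []) = StartsWith-++ _ s

-- The expected gain of one insertion

away-or-turn : ∀ b b′ c → b′ ≡ not c → b ≡ not c ⊎ b′ ≡ not b
away-or-turn true  _ false _ = inj₁ refl
away-or-turn false _ true  _ = inj₁ refl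
away-or-turn true  _ true  e = inj₂ e
away-or-turn false _ false e = inj₂ e

module Gain {p : ℚ} (0≤p : 0ℚ ≤ p) (p≤1 : p ≤ 1ℚ) where

  open ≤-Reasoning

  gain-root : ∀ {h} x → ℕtoℚ 0 + p * (1ℚ - p) ≤ expect (rebalanceZig p (node leaf x leaf) []) (depthℚ h)
  gain-root {h} x = begin
    ℕtoℚ 0 + p * (1ℚ - p)
      ≤⟨ p≤p+q (+-mono-≤ (0≤* (0≤1-p p≤1) (0≤1-p p≤1)) 0≤p) ⟩
    ℕtoℚ 0 + p * (1ℚ - p) + ((1ℚ - p) * (1ℚ - p) + p)
      ≡⟨ solve 1 (λ p → con 0ℚ :+ p :* (con 1ℚ :- p) :+ ((con 1ℚ :- p) :* (con 1ℚ :- p) :+ p)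
                        := con 1ℚ :* con 1ℚ :+ con 0ℚ) refl p ⟩
    1ℚ * ℕtoℚ 1 + 0ℚ
      ≡⟨ cong (λ n → 1ℚ * ℕtoℚ n + 0ℚ) (extDepth-singleton h x) ⟨
    1ℚ * depthℚ h (node leaf x leaf) + 0ℚ
      ∎

  -- With probability 1 - p the new node is rotated without lifting the gap.
  gain-away : ∀ {h x} f fs → All (OnPath h) (f ∷ fs) → isLeft f ≡ not (h <ᵇ x) →
    ℕtoℚ (length (f ∷ fs)) + p * (1ℚ - p) ≤ expect (rebalanceZig p (node leaf x leaf) (f ∷ fs)) (depthℚ h)
  gain-away {h} {x} f fs ons@(on ∷ ons′) away = begin
    N + p * (1ℚ - p)
      ≤⟨ p≤p+q (0≤* (0≤1-p p≤1) (0≤1-p p≤1)) ⟩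
    N + p * (1ℚ - p) + (1ℚ - p) * (1ℚ - p)
      ≡⟨ solve 2 (λ n p → n :+ p :* (con 1ℚ :- p) :+ (con 1ℚ :- p) :* (con 1ℚ :- p)
                          := (con 1ℚ :- p) :* (n :+ con 1ℚ) :+ p :* n) refl N p ⟩
    (1ℚ - p) * (N + 1ℚ) + p * N
      ≡⟨ cong (λ z → (1ℚ - p) * z + p * N) rotated ⟩
    (1ℚ - p) * D + p * N
      ≤⟨ +-monoʳ-≤ ((1ℚ - p) * D) (*-monoˡ-≤-0≤ 0≤p climbed) ⟩
    (1ℚ - p) * D + p * expect (rebalanceZig p (plugFrame v f) fs) (depthℚ h)
      ≡⟨ expect-rebalanceZig-∷ p v f fs (depthℚ h) ⟨
    expect (rebalanceZig p v (f ∷ fs)) (depthℚ h)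
      ∎
    where
    v = node leaf x leaf
    L = length fs
    N = ℕtoℚ (suc L)
    D = depthℚ h (plug (rotUp v f) fs)
    rotated : N + 1ℚ ≡ D
    rotated = trans (sym (ℕtoℚ-suc (suc L))) (cong ℕtoℚ (sym
      (trans (extDepth-plug (rotUp v f) fs ons′)
             (cong (ℕ._+ L) (trans (extDepth-rotUp-away leaf x leaf f on away)
                                   (cong suc (extDepth-singleton h x)))))))
    climbed : N ≤ expect (rebalanceZig p (plugFrame v f) fs) (depthℚ h)
    climbed = rebalanceZig-expect-≥ 0≤p p≤1 (plugFrame v f) fs ons′
      (ℕ.≤-reflexive (sym (extDepth-plug-singleton x (f ∷ fs) ons)))

  -- With probability p(1 - p) the parent of the new node is rotated without lifting the gap.
  gain-turn : ∀ {h x} f f′ fs → All (OnPath h) (f ∷ f′ ∷ fs) → isLeft f′ ≡ not (isLeft f) →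
    ℕtoℚ (length (f ∷ f′ ∷ fs)) + p * (1ℚ - p)
      ≤ expect (rebalanceZig p (node leaf x leaf) (f ∷ f′ ∷ fs)) (depthℚ h)
  gain-turn {h} {x} f f′ fs ons@(on ∷ on′ ∷ ons′) turn = begin
    N + p * (1ℚ - p)
      ≡⟨ solve 2 (λ n p → n :+ p :* (con 1ℚ :- p)
                          := (con 1ℚ :- p) :* n :+ p :* ((con 1ℚ :- p) :* (n :+ con 1ℚ) :+ p :* n)) refl N p ⟩
    (1ℚ - p) * N + p * ((1ℚ - p) * (N + 1ℚ) + p * N)
      ≡⟨ cong (λ z → (1ℚ - p) * N + p * ((1ℚ - p) * z + p * N)) rotatedParent ⟩
    (1ℚ - p) * N + p * ((1ℚ - p) * D′ + p * N)
      ≤⟨ +-mono-≤ (*-monoˡ-≤-0≤ (0≤1-p p≤1) rotatedNode)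
                  (*-monoˡ-≤-0≤ 0≤p (+-monoʳ-≤ ((1ℚ - p) * D′) (*-monoˡ-≤-0≤ 0≤p climbed))) ⟩
    (1ℚ - p) * D + p * ((1ℚ - p) * D′ + p * expect (rebalanceZig p (plugFrame w f′) fs) (depthℚ h))
      ≡⟨ cong ((1ℚ - p) * D +_) (cong (p *_) (expect-rebalanceZig-∷ p w f′ fs (depthℚ h))) ⟨
    (1ℚ - p) * D + p * expect (rebalanceZig p w (f′ ∷ fs)) (depthℚ h)
      ≡⟨ expect-rebalanceZig-∷ p v f (f′ ∷ fs) (depthℚ h) ⟨
    expect (rebalanceZig p v (f ∷ f′ ∷ fs)) (depthℚ h)
      ∎
    where
    v = node leaf x leaf
    w = plugFrame v f
    L = length fs
    N = ℕtoℚ (suc (suc L))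
    D = depthℚ h (plug (rotUp v f) (f′ ∷ fs))
    D′ = depthℚ h (plug (rotUp w f′) fs)
    rotatedNode : N ≤ D
    rotatedNode = ℕtoℚ-mono-≤ (ℕ.≤-pred (subst (ℕ._≤ suc (extDepth h (plug (rotUp v f) (f′ ∷ fs))))
      (extDepth-plug-singleton x (f ∷ f′ ∷ fs) ons) (extDepth-plug-rotUp v f (f′ ∷ fs) ons)))
    rotatedParent : N + 1ℚ ≡ D′
    rotatedParent = trans (sym (ℕtoℚ-suc (suc (suc L)))) (cong ℕtoℚ (sym
      (trans (extDepth-plug (rotUp w f′) fs ons′)
             (cong (ℕ._+ L) (trans (extDepth-rotUp-plugFrame-away v f f′ on on′ turn)
                                   (cong suc (extDepth-plug-singleton x (f ∷ []) (on ∷ []))))))))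
    climbed : N ≤ expect (rebalanceZig p (plugFrame w f′) fs) (depthℚ h)
    climbed = rebalanceZig-expect-≥ 0≤p p≤1 (plugFrame w f′) fs ons′
      (ℕ.≤-reflexive (sym (extDepth-plug-singleton x (f ∷ f′ ∷ fs) ons)))

  rebalanceZig-gain : ∀ {h x c} ctx → All (OnPath h) ctx → (h <ᵇ x) ≡ c → ReadyFor c (sides ctx) →
    ℕtoℚ (length ctx) + p * (1ℚ - p) ≤ expect (rebalanceZig p (node leaf x leaf) ctx) (depthℚ h)
  rebalanceZig-gain {x = x} []            _   _  _                   = gain-root x
  rebalanceZig-gain         (f ∷ [])      ons hx (inj₂ (first away)) =
    gain-away f [] ons (trans away (cong not (sym hx)))
  rebalanceZig-gain         (f ∷ f′ ∷ fs) ons hx (inj₂ (first away)) =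
    gain-away f (f′ ∷ fs) ons (trans away (cong not (sym hx)))
  rebalanceZig-gain {c = c} (f ∷ f′ ∷ fs) ons hx (inj₂ (second e))
    with away-or-turn (isLeft f) (isLeft f′) c e
  ... | inj₁ away = gain-away f (f′ ∷ fs) ons (trans away (cong not (sym hx)))
  ... | inj₂ turn = gain-turn f f′ fs ons turn

  insertZig-step : ∀ {h x c} t → AllKeys (SameSide x h) t → (h <ᵇ x) ≡ c →
    ReadyFor c (sides (searchPath h t [])) →
      depthℚ h t + p * (1ℚ - p) ≤ expect (insertZig p x t []) (depthℚ h)
    × weight (insertZig p x t []) ≡ 1ℚ
    × All (λ e → 0ℚ ≤ proj₁ e × InFirstTwo c (sides (searchPath h (proj₂ e) []))) (insertZig p x t [])
  insertZig-step {h} {x} t same hx ready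
    rewrite insertZig-searchPath p x t [] | searchPath-sameSide t [] same | extDepth≡length-searchPath h t =
      rebalanceZig-gain (searchPath h t []) onPath hx ready
    , rebalanceZig-weight p (node leaf x leaf) (searchPath h t [])
    , All.zip ( rebalanceZig-nonNeg 0≤p p≤1 _ _
              , rebalanceZig-inFirstTwo p _ _ onPath (startsWith-singleton hx))
    where
    onPath = searchPath-onPath h t []

  stepDist-gain : ∀ {x h h′} {P Q : ℚ × Tree → Set} {B} d →
    (∀ {w t} → P (w , t) → 0ℚ ≤ w
                         × depthℚ h t + p * (1ℚ - p) ≤ expect (insertZig p x t []) (depthℚ h′)
                         × weight (insertZig p x t []) ≡ 1ℚ
                         × All (λ e → Q (w * proj₁ e , proj₂ e)) (insertZig p x t [])) →
    All P d → weight d ≡ 1ℚ → B ≤ expect d (depthℚ h) →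
      All Q (stepDist p x d)
    × weight (stepDist p x d) ≡ 1ℚ
    × B + p * (1ℚ - p) ≤ expect (stepDist p x d) (depthℚ h′)
  stepDist-gain {x} {h} {h′} {P} {B = B} d step ps one bound =
      stepDist-All d (λ pw → proj₂ (proj₂ (proj₂ (step pw)))) ps
    , trans (stepDist-weight d (All.map (λ pw → proj₁ (proj₂ (proj₂ (step pw)))) ps)) one
    , (begin
        B + q                                ≡⟨ cong (B +_) (*-identityʳ q) ⟨
        B + q * 1ℚ                           ≡⟨ cong (λ w → B + q * w) one ⟨
        B + q * weight d                     ≤⟨ +-monoˡ-≤ (q * weight d) bound ⟩
        expect d (depthℚ h) + q * weight d   ≤⟨ stepDist-expect-≥ d (All.map gains ps) ⟩
        expect (stepDist p x d) (depthℚ h′)  ∎)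
    where
    q = p * (1ℚ - p)
    gains : ∀ {e} → P e →
      0ℚ ≤ proj₁ e × depthℚ h (proj₂ e) + q ≤ expect (insertZig p x (proj₂ e) []) (depthℚ h′)
    gains pw = proj₁ (step pw) , proj₁ (proj₂ (step pw))

upper : ℕ → ℕ → ℕ
upper j r = suc (j ℕ.+ (r ℕ.+ r))

upper-suc : ∀ j r → upper j (suc r) ≡ suc (upper (suc j) r)
upper-suc j r = unfolded j r
  where
  unfolded : ∀ j r → suc (j ℕ.+ (suc r ℕ.+ suc r)) ≡ suc (suc (suc (j ℕ.+ (r ℕ.+ r))))
  unfolded = solve-∀

double-+-suc : ∀ j r → 2 ℕ.* (j ℕ.+ suc r) ≡ j ℕ.+ upper (suc j) r
double-+-suc j r = unfolded j r
  where
  unfolded : ∀ j r → 2 ℕ.* (j ℕ.+ suc r) ≡ j ℕ.+ suc (suc (j ℕ.+ (r ℕ.+ r)))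
  unfolded = solve-∀

-- After j rounds of zigzag 0 (j + r) the keys 1, …, j and upper j r, …, 2(j + r) are present.
zigzag : ℕ → ℕ → List ℕ
zigzag j zero    = []
zigzag j (suc r) = suc j ∷ upper (suc j) r ∷ zigzag (suc j) r

zigzag-applyUpTo : ∀ r j (g : ℕ → ℕ) → (∀ i → g i ≡ j ℕ.+ i) →
  concat (map (λ k → k ∷ (suc (2 ℕ.* (j ℕ.+ r)) ℕ.∸ k) ∷ []) (map suc (applyUpTo g r))) ≡ zigzag j r
zigzag-applyUpTo zero    j g g≡ = refl
zigzag-applyUpTo (suc r) j g g≡ = cong₂ _∷_ (cong suc g0≡j) (cong₂ _∷_ partner rest)
  where
  g0≡j : g 0 ≡ j
  g0≡j = trans (g≡ 0) (ℕ.+-identityʳ j)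
  partner : 2 ℕ.* (j ℕ.+ suc r) ℕ.∸ g 0 ≡ upper (suc j) r
  partner rewrite g0≡j | double-+-suc j r = ℕ.m+n∸m≡n j _
  pairs : ℕ → List ℕ
  pairs n = concat (map (λ k → k ∷ (suc (2 ℕ.* n) ℕ.∸ k) ∷ []) (map suc (applyUpTo (g ∘ suc) r)))
  rest : pairs (j ℕ.+ suc r) ≡ zigzag (suc j) r
  rest = trans (cong pairs (ℕ.+-suc j r))
               (zigzag-applyUpTo r (suc j) (g ∘ suc) (λ i → trans (g≡ (suc i)) (ℕ.+-suc j i)))

altSeq≡zigzag : ∀ m → altSeq m ≡ zigzag 0 m
altSeq≡zigzag m = zigzag-applyUpTo m 0 id (λ _ → refl)

runFrom-zigzag : ∀ {p} (Stage : ℕ → ℕ → Dist → Set) →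
  (∀ {j r d} → Stage j (suc r) d → Stage (suc j) r (stepDist p (upper (suc j) r) (stepDist p (suc j) d))) →
  ∀ j r {d} → Stage j r d → Stage (j ℕ.+ r) 0 (runFrom p (zigzag j r) d)
runFrom-zigzag Stage round j zero s = subst (λ k → Stage k 0 _) (sym (ℕ.+-identityʳ j)) s
runFrom-zigzag {p} Stage round j (suc r) {d} s =
  subst (λ k → Stage k 0 (runFrom p (zigzag (suc j) r) (stepDist p (upper (suc j) r) (stepDist p (suc j) d))))
        (sym (ℕ.+-suc j r)) (runFrom-zigzag Stage round (suc j) r (round s))

module _ (j r : ℕ) where

  suc-j<upper : suc j ℕ.< upper j (suc r)
  suc-j<upper = s≤s (ℕ.m<m+n j z<s)

  small-gapShift : ∀ {y} → Outside j (upper j (suc r)) y → SameSide (suc j) j y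
  small-gapShift = sameSide-outside (ℕ.n≤1+n j) suc-j<upper ℕ.≤-refl (ℕ.<-trans (ℕ.n<1+n j) suc-j<upper)

  small-keys : ∀ {y} → Outside j (upper j (suc r)) y → Outside (suc j) (upper j (suc r)) y
  small-keys = Outside-mono (ℕ.n≤1+n j) ℕ.≤-refl

  big-sameSide : ∀ {y} → Outside (suc j) (upper j (suc r)) y → SameSide (upper (suc j) r) (suc j) y
  big-sameSide = sameSide-outside (ℕ.m≤n⇒m≤1+n (s≤s (ℕ.m≤m+n j _))) (ℕ.≤-reflexive (sym (upper-suc j r)))
                                  ℕ.≤-refl suc-j<upper

  big-keys : ∀ {y} → Outside (suc j) (upper j (suc r)) y → Outside (suc j) (upper (suc j) r) y
  big-keys = Outside-mono ℕ.≤-refl (ℕ.≤-trans (ℕ.n≤1+n _) (ℕ.≤-reflexive (sym (upper-suc j r))))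

  big-right : (suc j <ᵇ upper (suc j) r) ≡ true
  big-right = <⇒<ᵇ≡true (s≤s (s≤s (ℕ.m≤m+n j _)))

-- The expected depth of the middle gap

module ExpectedDepth {p : ℚ} (0≤p : 0ℚ ≤ p) (p≤1 : p ≤ 1ℚ) where

  open Gain 0≤p p≤1

  Before : ℕ → ℕ → ℚ × Tree → Set
  Before j r (w , t) =
    0ℚ ≤ w × AllKeys (Outside j (upper j r)) t × ReadyFor false (sides (searchPath j t []))

  Between : ℕ → ℕ → ℚ × Tree → Set
  Between j r (w , t) =
    0ℚ ≤ w × AllKeys (Outside (suc j) (upper j (suc r))) t × ReadyFor true (sides (searchPath (suc j) t []))

  Stage : ℕ → ℕ → Dist → Set
  Stage j r d = All (Before j r) d × weight d ≡ 1ℚ × p * (1ℚ - p) * ℕtoℚ (j ℕ.+ j) ≤ expect d (depthℚ j)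

  small-step : ∀ j r {w t} → Before j (suc r) (w , t) →
      0ℚ ≤ w
    × depthℚ j t + p * (1ℚ - p) ≤ expect (insertZig p (suc j) t []) (depthℚ (suc j))
    × weight (insertZig p (suc j) t []) ≡ 1ℚ
    × All (λ e → Between j r (w * proj₁ e , proj₂ e)) (insertZig p (suc j) t [])
  small-step j r {w} {t} (0≤w , keys , ready) =
      0≤w
    , subst (λ n → ℕtoℚ n + p * (1ℚ - p) ≤ expect (insertZig p (suc j) t []) (depthℚ (suc j)))
            (extDepth-sameSide t shift) gain
    , one
    , All.zipWith between (outcomes , insertZig-keys p _ t (AllKeys-map (small-keys j r) keys) (inj₁ ℕ.≤-refl))
    where
    shift = AllKeys-map (small-gapShift j r) keys
    step = insertZig-step t (AllKeys-universal (λ _ → refl) t) (≥⇒<ᵇ≡false (ℕ.≤-refl {suc j}))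
             (subst (λ path → ReadyFor false (sides path)) (sym (searchPath-sameSide t [] shift)) ready)
    gain = proj₁ step
    one = proj₁ (proj₂ step)
    outcomes = proj₂ (proj₂ step)
    between : ∀ {e} → (0ℚ ≤ proj₁ e × InFirstTwo false (sides (searchPath (suc j) (proj₂ e) [])))
                    × AllKeys (Outside (suc j) (upper j (suc r))) (proj₂ e)
                    → Between j r (w * proj₁ e , proj₂ e)
    between ((0≤w′ , near) , keys′) = 0≤* 0≤w 0≤w′ , keys′ , inj₂ near

  big-step : ∀ j r {w t} → Between j r (w , t) →
      0ℚ ≤ w
    × depthℚ (suc j) t + p * (1ℚ - p) ≤ expect (insertZig p (upper (suc j) r) t []) (depthℚ (suc j))
    × weight (insertZig p (upper (suc j) r) t []) ≡ 1ℚ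
    × All (λ e → Before (suc j) r (w * proj₁ e , proj₂ e)) (insertZig p (upper (suc j) r) t [])
  big-step j r {w} {t} (0≤w , keys , ready) =
      0≤w , gain , one
    , All.zipWith before (outcomes , insertZig-keys p _ t (AllKeys-map (big-keys j r) keys) (inj₂ ℕ.≤-refl))
    where
    step = insertZig-step t (AllKeys-map (big-sameSide j r) keys) (big-right j r) ready
    gain = proj₁ step
    one = proj₁ (proj₂ step)
    outcomes = proj₂ (proj₂ step)
    before : ∀ {e} → (0ℚ ≤ proj₁ e × InFirstTwo true (sides (searchPath (suc j) (proj₂ e) [])))
                   × AllKeys (Outside (suc j) (upper (suc j) r)) (proj₂ e)
                   → Before (suc j) r (w * proj₁ e , proj₂ e)
    before ((0≤w′ , near) , keys′) = 0≤* 0≤w 0≤w′ , keys′ , inj₂ near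

  round : ∀ {j r d} → Stage j (suc r) d → Stage (suc j) r (stepDist p (upper (suc j) r) (stepDist p (suc j) d))
  round {j} {r} {d} (before , one , bound)
    with stepDist-gain d (small-step j r) before one bound
  ... | between , one′ , bound′
    with stepDist-gain (stepDist p (suc j) d) (big-step j r) between one′ bound′
  ... | after , one″ , bound″ = after , one″ , ≤-trans (≤-reflexive two-more) bound″
    where
    q = p * (1ℚ - p)
    N = ℕtoℚ (j ℕ.+ j)
    two-more : q * ℕtoℚ (suc j ℕ.+ suc j) ≡ q * N + q + q
    two-more = begin
      q * ℕtoℚ (suc (j ℕ.+ suc j))
        ≡⟨ cong (λ n → q * ℕtoℚ (suc n)) (ℕ.+-suc j j) ⟩
      q * ℕtoℚ (suc (suc (j ℕ.+ j)))
        ≡⟨ cong (q *_) (trans (ℕtoℚ-suc (suc (j ℕ.+ j))) (cong (_+ 1ℚ) (ℕtoℚ-suc (j ℕ.+ j)))) ⟩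
      q * (N + 1ℚ + 1ℚ)
        ≡⟨ solve 2 (λ q N → q :* (N :+ con 1ℚ :+ con 1ℚ) := q :* N :+ q :+ q) refl q N ⟩
      q * N + q + q
        ∎
      where open ≡-Reasoning

  expected-depth : ∀ m → p * (1ℚ - p) * ℕtoℚ (m ℕ.+ m) ≤ expect (run p (altSeq m)) (depthℚ m)
  expected-depth m rewrite altSeq≡zigzag m = proj₂ (proj₂ (runFrom-zigzag Stage round 0 m initial))
    where
    initial : Stage 0 m ((1ℚ , leaf) ∷ [])
    initial = (0≤1 , leaf , inj₁ refl) ∷ [] , refl , ≤-reflexive (*-zeroʳ (p * (1ℚ - p)))

-- p = 1: plain insertion keeps a path towards the gap

data PathTo (h : ℕ) : Tree → Set where
  leaf  : PathTo h leaf
  left  : ∀ {l y} → (h <ᵇ y) ≡ true  → PathTo h l → PathTo h (node l y leaf)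
  right : ∀ {y r} → (h <ᵇ y) ≡ false → PathTo h r → PathTo h (node leaf y r)

data PathFrame (h : ℕ) : Frame → Set where
  left  : ∀ {y} → (h <ᵇ y) ≡ true  → PathFrame h (goL y leaf)
  right : ∀ {y} → (h <ᵇ y) ≡ false → PathFrame h (goR leaf y)

PathTo⇒IsPath : ∀ {h t} → PathTo h t → IsPath t
PathTo⇒IsPath leaf                   = path-leaf
PathTo⇒IsPath (left  {l} {y} _ path) = path-left l y (PathTo⇒IsPath path)
PathTo⇒IsPath (right {y} {r} _ path) = path-right y r (PathTo⇒IsPath path)

pathTo-singleton : ∀ h x → PathTo h (node leaf x leaf)
pathTo-singleton h x with h <ᵇ x in hx
... | true  = left hx leaf
... | false = right hx leaf

pathTo-sameSide : ∀ {a b t} → AllKeys (SameSide a b) t → PathTo b t → PathTo a t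
pathTo-sameSide leaf            leaf           = leaf
pathTo-sameSide (node kl ky _)  (left  e path) = left  (trans ky e) (pathTo-sameSide kl path)
pathTo-sameSide (node _  ky kr) (right e path) = right (trans ky e) (pathTo-sameSide kr path)

pathTo-plug : ∀ {h s} ctx → PathTo h s → All (PathFrame h) ctx → PathTo h (plug s ctx)
pathTo-plug []                path []              = path
pathTo-plug (goL y leaf ∷ fs) path (left  e ∷ pfs) = pathTo-plug fs (left e path) pfs
pathTo-plug (goR leaf y ∷ fs) path (right e ∷ pfs) = pathTo-plug fs (right e path) pfs

pathTo-searchPath : ∀ {h t} acc → PathTo h t → All (PathFrame h) acc → All (PathFrame h) (searchPath h t acc)
pathTo-searchPath acc leaf           pfs            = pfs
pathTo-searchPath acc (left  e path) pfs rewrite e = pathTo-searchPath _ path (left e ∷ pfs)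
pathTo-searchPath acc (right e path) pfs rewrite e = pathTo-searchPath _ path (right e ∷ pfs)

rebalanceZig-1 : ∀ v ctx → All (ZeroOr (_≡ plug v ctx)) (rebalanceZig 1ℚ v ctx)
rebalanceZig-1 v []       = inj₂ refl ∷ []
rebalanceZig-1 v (f ∷ fs) = inj₁ refl ∷ map⁺ (All.map unscaled (rebalanceZig-1 (plugFrame v f) fs))
  where
  unscaled : ∀ {e} → ZeroOr (_≡ plug v (f ∷ fs)) e → ZeroOr (_≡ plug v (f ∷ fs)) (1ℚ * proj₁ e , proj₂ e)
  unscaled (inj₁ w≡0) = inj₁ (trans (*-identityˡ _) w≡0)
  unscaled (inj₂ eq)  = inj₂ eq

insertZig-1 : ∀ {P h} x t → AllKeys (SameSide x h) t → AllKeys P t → P x → PathTo h t →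
  All (ZeroOr (λ t′ → AllKeys P t′ × PathTo h t′)) (insertZig 1ℚ x t [])
insertZig-1 {P} {h} x t same keys kx path =
  All.zipWith combine (insertZig-keys 1ℚ x t keys kx , outcomes)
  where
  inserted = plug (node leaf x leaf) (searchPath x t [])
  outcomes : All (ZeroOr (_≡ inserted)) (insertZig 1ℚ x t [])
  outcomes rewrite insertZig-searchPath 1ℚ x t [] = rebalanceZig-1 _ _
  path′ : PathTo h inserted
  path′ rewrite searchPath-sameSide t [] same =
    pathTo-plug _ (pathTo-singleton h x) (pathTo-searchPath [] path [])
  combine : ∀ {e} → AllKeys P (proj₂ e) × ZeroOr (_≡ inserted) e →
    ZeroOr (λ t′ → AllKeys P t′ × PathTo h t′) e
  combine (_     , inj₁ w≡0) = inj₁ w≡0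
  combine (keys′ , inj₂ eq)  = inj₂ (keys′ , subst (PathTo h) (sym eq) path′)

module AtOne where

  Stage : ℕ → ℕ → Dist → Set
  Stage j r = All (ZeroOr (λ t → AllKeys (Outside j (upper j r)) t × PathTo j t))

  round : ∀ {j r d} → Stage j (suc r) d →
    Stage (suc j) r (stepDist 1ℚ (upper (suc j) r) (stepDist 1ℚ (suc j) d))
  round {j} {r} {d} = stepDist-zeroOr _ big ∘ stepDist-zeroOr d small
    where
    small : ∀ {t} → AllKeys (Outside j (upper j (suc r))) t × PathTo j t →
      All (ZeroOr (λ t′ → AllKeys (Outside (suc j) (upper j (suc r))) t′ × PathTo (suc j) t′))
          (insertZig 1ℚ (suc j) t [])
    small {t} (keys , path) =
      insertZig-1 (suc j) t (AllKeys-universal (λ _ → refl) t) (AllKeys-map (small-keys j r) keys) (inj₁ ℕ.≤-refl)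
                  (pathTo-sameSide (AllKeys-map (small-gapShift j r) keys) path)
    big : ∀ {t} → AllKeys (Outside (suc j) (upper j (suc r))) t × PathTo (suc j) t →
      All (ZeroOr (λ t′ → AllKeys (Outside (suc j) (upper (suc j) r)) t′ × PathTo (suc j) t′))
          (insertZig 1ℚ (upper (suc j) r) t [])
    big {t} (keys , path) =
      insertZig-1 _ t (AllKeys-map (big-sameSide j r) keys) (AllKeys-map (big-keys j r) keys) (inj₂ ℕ.≤-refl) path

  run-isPath : ∀ m (w : ℚ) (t : Tree) → (w , t) ∈ run 1ℚ (altSeq m) → w ≢ 0ℚ → IsPath t
  run-isPath m rewrite altSeq≡zigzag m =
    zeroOr-IsPath (PathTo⇒IsPath ∘ proj₂) (runFrom-zigzag Stage round 0 m (inj₂ (leaf , leaf) ∷ []))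

-- p = 0: one rotation per insertion keeps a left spine

data LeftSpine : Tree → Set where
  leaf : LeftSpine leaf
  node : ∀ {l y} → LeftSpine l → LeftSpine (node l y leaf)

-- A left spine which the search for gap h leaves to the right of one of its nodes.
data LeftSpineGap (h : ℕ) : Tree → Set where
  below : ∀ {l y} → (h <ᵇ y) ≡ true  → LeftSpineGap h l → LeftSpineGap h (node l y leaf)
  exit  : ∀ {l y} → (h <ᵇ y) ≡ false → LeftSpine l     → LeftSpineGap h (node l y leaf)

data SpineFrame (h : ℕ) : Frame → Set where
  below : ∀ {y} → (h <ᵇ y) ≡ true → SpineFrame h (goL y leaf)

data SpineExit (h : ℕ) : Ctx → Set where
  exit : ∀ {l z fs} → LeftSpine l → (h <ᵇ z) ≡ false → All (SpineFrame h) fs → SpineExit h (goR l z ∷ fs)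

LeftSpine⇒IsPath : ∀ {t} → LeftSpine t → IsPath t
LeftSpine⇒IsPath leaf                 = path-leaf
LeftSpine⇒IsPath (node {l} {y} spine) = path-left l y (LeftSpine⇒IsPath spine)

LeftSpineGap⇒IsPath : ∀ {h t} → LeftSpineGap h t → IsPath t
LeftSpineGap⇒IsPath (below {l} {y} _ gap)   = path-left l y (LeftSpineGap⇒IsPath gap)
LeftSpineGap⇒IsPath (exit  {l} {y} _ spine) = path-left l y (LeftSpine⇒IsPath spine)

leftSpineGap-sameSide : ∀ {a b t} → AllKeys (SameSide a b) t → LeftSpineGap b t → LeftSpineGap a t
leftSpineGap-sameSide (node kl ky _) (below e gap)   = below (trans ky e) (leftSpineGap-sameSide kl gap)
leftSpineGap-sameSide (node _  ky _) (exit  e spine) = exit  (trans ky e) spine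

searchPath-spineExit : ∀ {h t} acc → LeftSpineGap h t → All (SpineFrame h) acc → SpineExit h (searchPath h t acc)
searchPath-spineExit acc (below e gap)   sfs rewrite e = searchPath-spineExit _ gap (below e ∷ sfs)
searchPath-spineExit acc (exit  e spine) sfs rewrite e = exit spine e sfs

leftSpineGap-plug : ∀ {h s} fs → LeftSpineGap h s → All (SpineFrame h) fs → LeftSpineGap h (plug s fs)
leftSpineGap-plug []                gap []              = gap
leftSpineGap-plug (goL y leaf ∷ fs) gap (below e ∷ sfs) = leftSpineGap-plug fs (below e gap) sfs

leftSpineGap-rotUp : ∀ {h l z} x → (h <ᵇ z) ≡ false → LeftSpine l →
  LeftSpineGap h (rotUp (node leaf x leaf) (goR l z))
leftSpineGap-rotUp {h} x ez spine with h <ᵇ x in ex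
... | true  = below ex (exit ez spine)
... | false = exit ex (node spine)

rebalanceZig-0 : ∀ v f fs → All (ZeroOr (_≡ plug (rotUp v f) fs)) (rebalanceZig 0ℚ v (f ∷ fs))
rebalanceZig-0 v f fs = inj₂ refl ∷ map⁺ (All.universal (λ e → inj₁ (*-zeroˡ (proj₁ e))) _)

insertZig-0 : ∀ {P h} x t → AllKeys (SameSide x h) t → AllKeys P t → P x →
  LeftSpineGap h t ⊎ (t ≡ leaf × (h <ᵇ x) ≡ false) →
  All (ZeroOr (λ t′ → AllKeys P t′ × LeftSpineGap h t′)) (insertZig 0ℚ x t [])
insertZig-0 {P} {h} x t same keys kx shape =
  All.zipWith combine (insertZig-keys 0ℚ x t keys kx , outcomes shape)
  where
  combine : ∀ {e} → AllKeys P (proj₂ e) × ZeroOr (LeftSpineGap h) e →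
    ZeroOr (λ t′ → AllKeys P t′ × LeftSpineGap h t′) e
  combine (_     , inj₁ w≡0) = inj₁ w≡0
  combine (keys′ , inj₂ gap) = inj₂ (keys′ , gap)
  outcomes : LeftSpineGap h t ⊎ (t ≡ leaf × (h <ᵇ x) ≡ false) →
    All (ZeroOr (LeftSpineGap h)) (insertZig 0ℚ x t [])
  outcomes (inj₂ (refl , hx)) = inj₂ (exit hx leaf) ∷ []
  outcomes (inj₁ gap) rewrite insertZig-searchPath 0ℚ x t [] | searchPath-sameSide t [] same
    with searchPath h t [] | searchPath-spineExit [] gap []
  ... | goR l z ∷ fs | exit spine ez sfs =
    All.map (ZeroOr-map (_≡ rotated) (LeftSpineGap h)
                        λ { refl → leftSpineGap-plug fs (leftSpineGap-rotUp x ez spine) sfs })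
            (rebalanceZig-0 (node leaf x leaf) (goR l z) fs)
    where
    rotated = plug (rotUp (node leaf x leaf) (goR l z)) fs

module AtZero where

  Stage : ℕ → ℕ → Dist → Set
  Stage j r = All (ZeroOr (λ t → AllKeys (Outside j (upper j r)) t × (LeftSpineGap j t ⊎ t ≡ leaf)))

  round : ∀ {j r d} → Stage j (suc r) d →
    Stage (suc j) r (stepDist 0ℚ (upper (suc j) r) (stepDist 0ℚ (suc j) d))
  round {j} {r} {d} = stepDist-zeroOr _ big ∘ stepDist-zeroOr d small
    where
    small : ∀ {t} → AllKeys (Outside j (upper j (suc r))) t × (LeftSpineGap j t ⊎ t ≡ leaf) →
      All (ZeroOr (λ t′ → AllKeys (Outside (suc j) (upper j (suc r))) t′ × LeftSpineGap (suc j) t′))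
          (insertZig 0ℚ (suc j) t [])
    small {t} (keys , shape) =
      insertZig-0 (suc j) t (AllKeys-universal (λ _ → refl) t) (AllKeys-map (small-keys j r) keys) (inj₁ ℕ.≤-refl)
                  (shifted shape)
      where
      shifted : LeftSpineGap j t ⊎ t ≡ leaf → LeftSpineGap (suc j) t ⊎ (t ≡ leaf × (suc j <ᵇ suc j) ≡ false)
      shifted (inj₁ gap)    = inj₁ (leftSpineGap-sameSide (AllKeys-map (small-gapShift j r) keys) gap)
      shifted (inj₂ t≡leaf) = inj₂ (t≡leaf , ≥⇒<ᵇ≡false (ℕ.≤-refl {suc j}))
    Keys : Tree → Set
    Keys = AllKeys (Outside (suc j) (upper (suc j) r))
    big : ∀ {t} → AllKeys (Outside (suc j) (upper j (suc r))) t × LeftSpineGap (suc j) t →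
      All (ZeroOr (λ t′ → Keys t′ × (LeftSpineGap (suc j) t′ ⊎ t′ ≡ leaf)))
          (insertZig 0ℚ (upper (suc j) r) t [])
    big {t} (keys , gap) =
      All.map (ZeroOr-map (λ t′ → Keys t′ × LeftSpineGap (suc j) t′)
                          (λ t′ → Keys t′ × (LeftSpineGap (suc j) t′ ⊎ t′ ≡ leaf))
                          λ (keys′ , gap′) → keys′ , inj₁ gap′)
              (insertZig-0 _ t (AllKeys-map (big-sameSide j r) keys) (AllKeys-map (big-keys j r) keys)
                           (inj₂ ℕ.≤-refl) (inj₁ gap))

  run-isPath : ∀ m (w : ℚ) (t : Tree) → (w , t) ∈ run 0ℚ (altSeq m) → w ≢ 0ℚ → IsPath t
  run-isPath m rewrite altSeq≡zigzag m =
    zeroOr-IsPath isPath (runFrom-zigzag Stage round 0 m (inj₂ (leaf , inj₂ refl) ∷ []))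
    where
    isPath : ∀ {t} → AllKeys (Outside m (upper m 0)) t × (LeftSpineGap m t ⊎ t ≡ leaf) → IsPath t
    isPath (_ , inj₁ gap)  = LeftSpineGap⇒IsPath gap
    isPath (_ , inj₂ refl) = path-leaf

halve-≤ : ∀ a b → 0ℚ ≤ a * b → a * ½ * b ≤ a * b
halve-≤ a b 0≤ab = begin
  a * ½ * b                ≤⟨ p≤p+q (0≤* (<⇒≤ (positive⁻¹ ½)) 0≤ab) ⟩
  a * ½ * b + ½ * (a * b)  ≡⟨ solve 2 (λ a b → a :* con ½ :* b :+ con ½ :* (a :* b) := a :* b) refl a b ⟩
  a * b                    ∎
  where open ≤-Reasoning

lemma12 : (m : ℕ) →
    ((p : ℚ) → 0ℚ < p → p < 1ℚ →
      Σ ℕ (λ i → (i Data.Nat.≤ 2 Data.Nat.* m) ×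
        ((p * (1ℚ - p) * ½) * ℕtoℚ (2 Data.Nat.* m) ≤ expect (run p (altSeq m)) (λ t → ℕtoℚ (extDepth i t)))))
    × ((w : ℚ) (t : Tree) → (w , t) ∈ run 0ℚ (altSeq m) → w ≢ 0ℚ → IsPath t)
    × ((w : ℚ) (t : Tree) → (w , t) ∈ run 1ℚ (altSeq m) → w ≢ 0ℚ → IsPath t)
lemma12 m = middle-gap , AtZero.run-isPath m , AtOne.run-isPath m
  where
  middle-gap : (p : ℚ) → 0ℚ < p → p < 1ℚ → Σ ℕ (λ i → (i ℕ.≤ 2 ℕ.* m) ×
    (p * (1ℚ - p) * ½ * ℕtoℚ (2 ℕ.* m) ≤ expect (run p (altSeq m)) (depthℚ i)))
  middle-gap p 0<p p<1 = m , ℕ.m≤m+n m _ , (begin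
    p * (1ℚ - p) * ½ * ℕtoℚ (2 ℕ.* m)
      ≡⟨ cong (λ n → p * (1ℚ - p) * ½ * ℕtoℚ (m ℕ.+ n)) (ℕ.+-identityʳ m) ⟩
    p * (1ℚ - p) * ½ * ℕtoℚ (m ℕ.+ m)
      ≤⟨ halve-≤ (p * (1ℚ - p)) (ℕtoℚ (m ℕ.+ m)) 0≤qN ⟩
    p * (1ℚ - p) * ℕtoℚ (m ℕ.+ m)
      ≤⟨ ExpectedDepth.expected-depth 0≤p p≤1 m ⟩
    expect (run p (altSeq m)) (depthℚ m)
      ∎)
    where
    open ≤-Reasoning
    0≤p = <⇒≤ 0<p
    p≤1 = <⇒≤ p<1
    0≤qN = 0≤* (0≤* 0≤p (0≤1-p p≤1)) (ℕtoℚ-nonNeg (m ℕ.+ m))
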